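{- Let $\Gamma$ be a finite graph that is locally $n\times n$ grid, let $x$ be a vertex and $C$ a maximal clique of $\Gamma$ not containing $x$. (1) If $d_\Gamma(x,C)=1$ then $|C\cap\Gamma(x)|=2$ and $|C\cap\Gamma_2(x)|=n-1$. (2) If $d_\Gamma(x,C)=2$ then every $y\in C\cap\Gamma_2(x)$ satisfies $c_2(x,y)\leq 2(n-1)$, and if $c_2(x,y)=2m$ then $|C\cap\Gamma_2(x)|\geq m+1$.
   Context: A graph is locally $n\times n$ grid if the induced subgraph on every vertex neighbourhood $\Gamma(x)$ is isomorphic to $K_n\square K_n$ (vertices $(i,j)$, $1\le i,j\le n$, adjacent iff they agree in exactly one coordinate). $\Gamma_i(x)$ is the set of vertices at distance $i$ from $x$; $c_2(x,y)=|\Gamma(x)\cap\Gamma(y)|$; $d_\Gamma(x,C)=\min_{z\in C}d_\Gamma(x,z)$. -}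

module Defs where

open import Level using (0ℓ)
open import Data.Nat using (ℕ; zero; suc; _≤_; _<_)
open import Data.Fin using (Fin)
open import Data.Fin.Subset using (Subset; _∈_; _∉_; _⊆_)
open import Data.List using (List; length)
open import Data.List.Relation.Unary.Unique.Propositional using (Unique)
import Data.List.Membership.Propositional as LM
open import Data.Product using (Σ; _×_; ∃; ∃-syntax)
open import Data.Sum using (_⊎_)
open import Relation.Nullary using (¬_)
open import Relation.Binary.PropositionalEquality using (_≡_; _≢_)
open import Relation.Binary using (Decidable)

record Graph : Set₁ where
  field
    N     : ℕ
    Adj   : Fin N → Fin N → Set
    adj?  : Decidable Adj
    sym   : ∀ {u v} → Adj u v → Adj v u
    irrefl : ∀ {u} → ¬ Adj u u

module _ (G : Graph) where
  open Graph G

  Vertex : Set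
  Vertex = Fin N

  data Walk : Vertex → Vertex → ℕ → Set where
    here : ∀ {x} → Walk x x zero
    step : ∀ {x y z k} → Adj x y → Walk y z k → Walk x z (suc k)

  Dist : Vertex → Vertex → ℕ → Set
  Dist x y k = Walk x y k × (∀ j → j < k → ¬ Walk x y j)

  Γ_ : ℕ → Vertex → Vertex → Set
  Γ_ i x y = Dist x y i

  DistSet : Vertex → Subset N → ℕ → Set
  DistSet x C k = (∃[ z ] (z ∈ C × Walk x z k))
                × (∀ z j → z ∈ C → Walk x z j → k ≤ j)

  IsClique : Subset N → Set
  IsClique C = ∀ u v → u ∈ C → v ∈ C → u ≢ v → Adj u v

  IsMaximalClique : Subset N → Set
  IsMaximalClique C = IsClique C × (∀ D → IsClique D → C ⊆ D → D ⊆ C)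

  -- Common neighbours of x and y (the set whose size is c_2(x,y))
  CommonNbr : Vertex → Vertex → Vertex → Set
  CommonNbr x y z = Adj x z × Adj y z

GridAdj : ∀ {n} → Fin n → Fin n → Fin n → Fin n → Set
GridAdj i j k l = (i ≡ k × j ≢ l) ⊎ (i ≢ k × j ≡ l)

-- The induced subgraph on Γ(x) is isomorphic to K_n □ K_n, via
-- a bijection f : [n]×[n] → Γ(x) preserving and reflecting adjacency.
LocallyGridAt : (G : Graph) → ℕ → Fin (Graph.N G) → Set
LocallyGridAt G n x =
  Σ (Fin n → Fin n → Fin N) λ f →
      (∀ i j → Adj x (f i j))
    × (∀ i j k l → f i j ≡ f k l → i ≡ k × j ≡ l)
    × (∀ y → Adj x y → ∃[ i ] ∃[ j ] (f i j ≡ y))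
    × (∀ i j k l → (Adj (f i j) (f k l) → GridAdj i j k l)
                 × (GridAdj i j k l → Adj (f i j) (f k l)))
  where open Graph G

LocallyGrid : Graph → ℕ → Set
LocallyGrid G n = ∀ x → LocallyGridAt G n x

-- Cardinalities of subsets of a finite vertex set, via duplicate-free lists.
module _ {N : ℕ} where
  open LM using () renaming (_∈_ to _∈ₗ_)

  HasSize : (Fin N → Set) → ℕ → Set
  HasSize P k = Σ (List (Fin N)) λ xs →
    Unique xs × (∀ v → (v ∈ₗ xs → P v) × (P v → v ∈ₗ xs)) × length xs ≡ k

  AtMost : (Fin N → Set) → ℕ → Set
  AtMost P k = ∀ (xs : List (Fin N)) → Unique xs → (∀ v → v ∈ₗ xs → P v) → length xs ≤ k

  AtLeast : (Fin N → Set) → ℕ → Set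
  AtLeast P k = Σ (List (Fin N)) λ xs →
    Unique xs × (∀ v → v ∈ₗ xs → P v) × k ≤ length xs

module Submission where

-- (A) Lines.  For z ∈ C, the set C \ {z} is a clique of Γ(z) ≅ K_n □ K_n,
--     and maximality of C forces it to be a whole line of the grid: in a
--     suitably oriented chart at z it is exactly a row i.
-- (B) No triangles.  If d(x,y) = 2, no three common neighbours of x and y
--     are pairwise adjacent: in the chart at one of them the other two form
--     an edge, and two distinct common neighbours of an edge of K_n □ K_n
--     are adjacent, so x ~ y.
--
-- Part (1): for z ∈ C ∩ Γ(x), x sits off the line of the chart at z and its
-- only neighbour on it is the line point g i b of its own column; hence
-- C ∩ Γ(x) = {z, g i b} and C ∩ Γ₂(x) is the line minus g i b.
-- Part (2): for y ∈ C ∩ Γ₂(x), the common neighbours of x and y lie off the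
-- line in the chart at y; two on a common row or column are adjacent, so by
-- (B) every row and column carries at most two of them.  A counting lemma
-- (at most two entries per fibre ⇒ at least half as many values) bounds
-- c₂(x,y) by twice the n - 1 rows off the line, and turns c₂(x,y) = 2m into
-- m columns whose line points, together with y, lie in C ∩ Γ₂(x).

open import Defs
open import Data.Nat using (ℕ; zero; suc; _*_; _∸_; _+_; _≤_; _<_; z≤n; s≤s)
open import Data.Nat.Properties
  using (≤-refl; ≤-trans; +-mono-≤; +-suc; +-comm; *-suc; *-monoʳ-≤; *-cancelˡ-≤; ∸-monoˡ-≤)
open import Data.Fin using (Fin; punchIn; punchOut)
open import Data.Fin.Properties
  using (any?; punchIn-injective; punchInᵢ≢i; punchIn-punchOut) renaming (_≟_ to _≟ᶠ_)
open import Data.Fin.Subset using (Subset; _∈_; _∉_; ⁅_⁆; _∪_)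
open import Data.Fin.Subset.Properties using (_∈?_; x∈⁅x⁆; x∈⁅y⁆⇒x≡y; x∈p∪q⁻; x∈p∪q⁺)
open import Data.List using (List; []; _∷_; length; map; filter; allFin)
open import Data.List.Properties using (length-map; length-tabulate; length-filter; length-removeAt′)
open import Data.List.Relation.Unary.Unique.Propositional using (Unique)
open import Data.List.Relation.Unary.AllPairs using ([]; _∷_)
import Data.List.Relation.Unary.Unique.Propositional.Properties as Unique
open import Data.List.Relation.Unary.All as All using (All; []; _∷_)
open import Data.List.Relation.Unary.Any using (here; there; index)
open import Data.List.Membership.Propositional using (_─_) renaming (_∈_ to _∈ₗ_)
open import Data.List.Membership.Propositional.Properties using (∈-map⁺; ∈-map⁻; ∈-filter⁻; ∈-allFin)
open import Data.Product using (Σ; _×_; _,_; proj₁; proj₂; ∃; ∃-syntax; swap)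
open import Data.Sum using (inj₁; inj₂)
open import Data.Empty using (⊥; ⊥-elim)
open import Function using (_∘_; id)
open import Relation.Nullary using (¬_; Dec; yes; no)
open import Relation.Nullary.Decidable using (_×-dec_; ¬?)
open import Relation.Unary using (Pred; Decidable)
open import Relation.Binary using (DecidableEquality)
open import Relation.Binary.PropositionalEquality

module _ {A : Set} where

  ∈-─ : ∀ {v x} {ys : List A} → v ∈ₗ ys → (x∈ys : x ∈ₗ ys) → v ≢ x → v ∈ₗ ys ─ x∈ys
  ∈-─ (here v≡y)  (here x≡y)  v≢x = ⊥-elim (v≢x (trans v≡y (sym x≡y)))
  ∈-─ (there v∈ys) (here _)   _   = v∈ys
  ∈-─ (here v≡y)  (there _)   _   = here v≡y
  ∈-─ (there v∈ys) (there x∈ys) v≢x = there (∈-─ v∈ys x∈ys v≢x)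

  unique-⊆⇒length≤ : ∀ {xs ys : List A} → Unique xs →
    (∀ {v} → v ∈ₗ xs → v ∈ₗ ys) → length xs ≤ length ys
  unique-⊆⇒length≤ {[]}     _             _   = z≤n
  unique-⊆⇒length≤ {x ∷ xs} {ys} (x∉xs ∷ uxs) xs⊆ys =
    subst (suc (length xs) ≤_) (sym (length-removeAt′ ys (index x∈ys)))
      (s≤s (unique-⊆⇒length≤ uxs λ v∈xs →
        ∈-─ (xs⊆ys (there v∈xs)) x∈ys (λ v≡x → All.lookup x∉xs v∈xs (sym v≡x))))
    where
    x∈ys : x ∈ₗ ys
    x∈ys = xs⊆ys (here refl)

  unique-constant⇒length≤1 : ∀ {ys : List A} → Unique ys →
    (∀ {p q} → p ∈ₗ ys → q ∈ₗ ys → p ≢ q → ⊥) → length ys ≤ 1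
  unique-constant⇒length≤1 {[]}         _             _ = z≤n
  unique-constant⇒length≤1 {_ ∷ []}     _             _ = s≤s z≤n
  unique-constant⇒length≤1 {_ ∷ _ ∷ _} ((p≢q ∷ _) ∷ _) distinct =
    ⊥-elim (distinct (here refl) (there (here refl)) p≢q)

  length-filter-∁ : ∀ {p} {P : Pred A p} (P? : Decidable P) xs →
    length (filter P? xs) + length (filter (¬? ∘ P?) xs) ≡ length xs
  length-filter-∁ P? []       = refl
  length-filter-∁ P? (x ∷ xs) with P? x
  ... | yes _ = cong suc (length-filter-∁ P? xs)
  ... | no  _ = trans (+-suc _ _) (cong suc (length-filter-∁ P? xs))

unique-avoiding⇒length≤n∸1 : ∀ {n} {i : Fin n} {I : List (Fin n)} →
  Unique I → All (i ≢_) I → length I ≤ n ∸ 1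
unique-avoiding⇒length≤n∸1 {n} {i} {I} uI i∉I = ∸-monoˡ-≤ {suc (length I)} {n} 1
  (subst (suc (length I) ≤_) (length-tabulate id)
    (unique-⊆⇒length≤ (i∉I ∷ uI) (λ {v} _ → ∈-allFin v)))

punctured-image : ∀ {A : Set} {n} (b : Fin n) (h : Fin n → A) →
  (∀ {k l} → h k ≡ h l → k ≡ l) →
  Σ (List A) λ vs → Unique vs
    × (∀ {v} → v ∈ₗ vs → ∃ λ k → k ≢ b × h k ≡ v)
    × (∀ {k} → k ≢ b → h k ∈ₗ vs)
    × length vs ≡ n ∸ 1
punctured-image {n = suc n} b h h-inj =
    map (h ∘ punchIn b) (allFin n)
  , Unique.map⁺ (punchIn-injective b _ _ ∘ h-inj) (Unique.allFin⁺ n)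
  , (λ v∈vs → let k , _ , v≡ = ∈-map⁻ (h ∘ punchIn b) v∈vs in
              punchIn b k , punchInᵢ≢i b k , sym v≡)
  , (λ k≢b → subst (λ t → h t ∈ₗ map (h ∘ punchIn b) (allFin n))
                   (punchIn-punchOut (k≢b ∘ sym))
                   (∈-map⁺ (h ∘ punchIn b) (∈-allFin (punchOut (k≢b ∘ sym)))))
  , trans (length-map _ (allFin n)) (length-tabulate id)

module FibreCounting {A B : Set} (_≟_ : DecidableEquality B) (r : A → B) where

  AtMostTwoPerFibre : List A → Set
  AtMostTwoPerFibre xs = ∀ {p q s} → p ∈ₗ xs → q ∈ₗ xs → s ∈ₗ xs →
    p ≢ q → p ≢ s → q ≢ s → r p ≡ r q → r p ≡ r s → ⊥

  Realised : List A → List B → Set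
  Realised xs I = ∀ {b} → b ∈ₗ I → ∃ λ v → v ∈ₗ xs × r v ≡ b

  HalfImage : List A → Set
  HalfImage xs = Σ (List B) λ I → Unique I × Realised xs I × length xs ≤ 2 * length I

  -- Split off the fibre of r a (at most one further entry) and recurse on
  -- the rest; the fuel k bounds the length of the list.
  half-image : ∀ xs → Unique xs → AtMostTwoPerFibre xs → HalfImage xs
  half-image xs = go (length xs) xs ≤-refl
    where
    go : ∀ k xs → length xs ≤ k → Unique xs → AtMostTwoPerFibre xs → HalfImage xs
    go k       []       _            _           _  = [] , [] , (λ ()) , z≤n
    go (suc k) (a ∷ xs) (s≤s |xs|≤k) (a∉xs ∷ uxs) ≤2 =
      r a ∷ I , ra∉I ∷ uI , realised , length-bound
      where
      same? : ∀ v → Dec (r v ≡ r a)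
      same? v = r v ≟ r a
      rest : List A
      rest = filter (¬? ∘ same?) xs
      rest⊆xs : ∀ {v} → v ∈ₗ rest → v ∈ₗ xs
      rest⊆xs = proj₁ ∘ ∈-filter⁻ (¬? ∘ same?)
      IH : HalfImage rest
      IH = go k rest (≤-trans (length-filter (¬? ∘ same?) xs) |xs|≤k)
             (Unique.filter⁺ (¬? ∘ same?) uxs)
             (λ p q s → ≤2 (there (rest⊆xs p)) (there (rest⊆xs q)) (there (rest⊆xs s)))
      I : List B
      I = proj₁ IH
      uI : Unique I
      uI = proj₁ (proj₂ IH)
      realisedI : Realised rest I
      realisedI = proj₁ (proj₂ (proj₂ IH))
      ra∉I : All (r a ≢_) I
      ra∉I = All.tabulate λ b∈I ra≡b → let v , v∈rest , rv≡b = realisedI b∈I in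
        proj₂ (∈-filter⁻ (¬? ∘ same?) {xs = xs} v∈rest) (trans rv≡b (sym ra≡b))
      realised : Realised (a ∷ xs) (r a ∷ I)
      realised (here refl) = a , here refl , refl
      realised (there b∈I) = let v , v∈rest , rv≡b = realisedI b∈I in
        v , there (rest⊆xs v∈rest) , rv≡b
      |same|≤1 : length (filter same? xs) ≤ 1
      |same|≤1 = unique-constant⇒length≤1 (Unique.filter⁺ same? uxs) λ p∈ q∈ p≢q →
        let p∈xs , rp≡ = ∈-filter⁻ same? {xs = xs} p∈
            q∈xs , rq≡ = ∈-filter⁻ same? {xs = xs} q∈
        in ≤2 (here refl) (there p∈xs) (there q∈xs)
              (All.lookup a∉xs p∈xs) (All.lookup a∉xs q∈xs) p≢q (sym rp≡) (sym rq≡)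
      length-bound : suc (length xs) ≤ 2 * suc (length I)
      length-bound = subst₂ _≤_
        (cong suc (length-filter-∁ same? xs)) (sym (*-suc 2 (length I)))
        (+-mono-≤ (s≤s |same|≤1) (proj₂ (proj₂ (proj₂ IH))))

module GridGeometry where
  private variable
    n : ℕ
    i j k l p₁ p₂ q₁ q₂ r₁ r₂ s₁ s₂ : Fin n

  GridAdj-transpose : GridAdj i j k l → GridAdj j i l k
  GridAdj-transpose (inj₁ (i≡k , j≢l)) = inj₂ (j≢l , i≡k)
  GridAdj-transpose (inj₂ (i≢k , j≡l)) = inj₁ (j≡l , i≢k)

  row-edge-common-neighbour : p₁ ≡ q₁ → p₂ ≢ q₂ →
    GridAdj p₁ p₂ r₁ r₂ → GridAdj q₁ q₂ r₁ r₂ → p₁ ≡ r₁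
  row-edge-common-neighbour _    _     (inj₁ (p₁≡r₁ , _)) _                  = p₁≡r₁
  row-edge-common-neighbour p≡q₁ _     (inj₂ (p₁≢r₁ , _)) (inj₁ (q₁≡r₁ , _)) =
    ⊥-elim (p₁≢r₁ (trans p≡q₁ q₁≡r₁))
  row-edge-common-neighbour _    p₂≢q₂ (inj₂ (_ , p₂≡r₂)) (inj₂ (_ , q₂≡r₂)) =
    ⊥-elim (p₂≢q₂ (trans p₂≡r₂ (sym q₂≡r₂)))

  row-edge-common-neighbours-adjacent : p₁ ≡ q₁ → p₂ ≢ q₂ →
    GridAdj p₁ p₂ r₁ r₂ → GridAdj q₁ q₂ r₁ r₂ →
    GridAdj p₁ p₂ s₁ s₂ → GridAdj q₁ q₂ s₁ s₂ →
    ¬ (r₁ ≡ s₁ × r₂ ≡ s₂) → GridAdj r₁ r₂ s₁ s₂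
  row-edge-common-neighbours-adjacent {r₁ = r₁} {s₁ = s₁} p≡q₁ p₂≢q₂ pr qr ps qs r≢s =
    inj₁ (r₁≡s₁ , λ r₂≡s₂ → r≢s (r₁≡s₁ , r₂≡s₂))
    where
    r₁≡s₁ : r₁ ≡ s₁
    r₁≡s₁ = trans (sym (row-edge-common-neighbour p≡q₁ p₂≢q₂ pr qr))
                  (row-edge-common-neighbour p≡q₁ p₂≢q₂ ps qs)

  edge-common-neighbours-adjacent : GridAdj p₁ p₂ q₁ q₂ →
    GridAdj p₁ p₂ r₁ r₂ → GridAdj q₁ q₂ r₁ r₂ →
    GridAdj p₁ p₂ s₁ s₂ → GridAdj q₁ q₂ s₁ s₂ →
    ¬ (r₁ ≡ s₁ × r₂ ≡ s₂) → GridAdj r₁ r₂ s₁ s₂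
  edge-common-neighbours-adjacent (inj₁ (p≡q₁ , p₂≢q₂)) =
    row-edge-common-neighbours-adjacent p≡q₁ p₂≢q₂
  edge-common-neighbours-adjacent (inj₂ (p₁≢q₁ , p≡q₂)) pr qr ps qs r≢s =
    GridAdj-transpose (row-edge-common-neighbours-adjacent p≡q₂ p₁≢q₁
      (GridAdj-transpose pr) (GridAdj-transpose qr)
      (GridAdj-transpose ps) (GridAdj-transpose qs) (r≢s ∘ swap))

open GridGeometry

module GraphFacts (G : Graph) where
  open Graph G renaming (sym to Adj-sym)

  private variable
    x u v z : Fin N

  walk₀⇒≡ : Walk G x v 0 → x ≡ v
  walk₀⇒≡ here = refl

  walk₁⇒Adj : Walk G x v 1 → Adj x v
  walk₁⇒Adj (step x~v here) = x~v

  Γ₂-intro : Adj x u → Adj u v → x ≢ v → ¬ Adj x v → Γ_ G 2 x v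
  Γ₂-intro {x} {v = v} x~u u~v x≢v x≁v = step x~u (step u~v here) , shorter
    where
    shorter : ∀ j → j < 2 → ¬ Walk G x v j
    shorter zero          _                 w = x≢v (walk₀⇒≡ w)
    shorter (suc zero)    _                 w = x≁v (walk₁⇒Adj w)
    shorter (suc (suc j)) (s≤s (s≤s ())) _

  Γ₂⇒≢ : Γ_ G 2 x v → x ≢ v
  Γ₂⇒≢ (_ , shorter) refl = shorter 0 (s≤s z≤n) here

  Γ₂⇒≁ : Γ_ G 2 x v → ¬ Adj x v
  Γ₂⇒≁ (_ , shorter) x~v = shorter 1 (s≤s (s≤s z≤n)) (step x~v here)

  Γ₂-middle : Γ_ G 2 x v → ∃ λ u → Adj x u × Adj u v
  Γ₂-middle (step x~u (step u~v here) , _) = _ , x~u , u~v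

  at-distance-two⇒non-adjacent : ∀ {C} → DistSet G x C 2 → ∀ {c} → c ∈ C → ¬ Adj x c
  at-distance-two⇒non-adjacent (_ , nearest) {c} c∈C x~c with nearest c 1 c∈C (step x~c here)
  ... | s≤s ()

  extend-clique : ∀ {C} → IsClique G C → (∀ {c} → c ∈ C → c ≢ v → Adj c v) →
    IsClique G (⁅ v ⁆ ∪ C)
  extend-clique {v} {C} C-clique c~v a b a∈ b∈ a≢b
    with x∈p∪q⁻ ⁅ v ⁆ C a∈ | x∈p∪q⁻ ⁅ v ⁆ C b∈
  ... | inj₁ a∈v | inj₁ b∈v = ⊥-elim (a≢b (trans (x∈⁅y⁆⇒x≡y v a∈v) (sym (x∈⁅y⁆⇒x≡y v b∈v))))
  ... | inj₁ a∈v | inj₂ b∈C rewrite x∈⁅y⁆⇒x≡y v a∈v = Adj-sym (c~v b∈C (a≢b ∘ sym))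
  ... | inj₂ a∈C | inj₁ b∈v rewrite x∈⁅y⁆⇒x≡y v b∈v = c~v a∈C a≢b
  ... | inj₂ a∈C | inj₂ b∈C = C-clique a b a∈C b∈C a≢b

  module MaximalClique {C : Subset N} (C-max : IsMaximalClique G C) where

    C-clique : IsClique G C
    C-clique = proj₁ C-max

    -- A vertex outside C has a non-neighbour in C: otherwise C ∪ {v} would
    -- be a strictly larger clique.
    non-neighbour : v ∉ C → ∃ λ c → c ∈ C × c ≢ v × ¬ Adj c v
    non-neighbour {v} v∉C
      with any? (λ c → (c ∈? C) ×-dec ¬? (c ≟ᶠ v) ×-dec ¬? (adj? c v))
    ... | yes found = found
    ... | no  none  = ⊥-elim (v∉C (proj₂ C-max (⁅ v ⁆ ∪ C)
            (extend-clique C-clique c~v) (x∈p∪q⁺ ∘ inj₂) (x∈p∪q⁺ (inj₁ (x∈⁅x⁆ v)))))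
      where
      c~v : ∀ {c} → c ∈ C → c ≢ v → Adj c v
      c~v {c} c∈C c≢v with adj? c v
      ... | yes c~v′ = c~v′
      ... | no  c≁v  = ⊥-elim (none (c , c∈C , c≢v , c≁v))

    second-member : z ∈ C → Adj z u → ∃ λ w → w ∈ C × w ≢ z
    second-member {z} {u} z∈C z~u with u ∈? C
    ... | yes u∈C = u , u∈C , λ u≡z → irrefl (subst (Adj z) u≡z z~u)
    ... | no  u∉C = let c , c∈C , _ , c≁u = non-neighbour u∉C in
                    c , c∈C , λ c≡z → c≁u (subst (λ t → Adj t u) (sym c≡z) z~u)

module Charts (G : Graph) (n : ℕ) where
  open Graph G renaming (sym to Adj-sym)

  private variable
    z x y p q s u v : Fin N

  record Chart (z : Fin N) : Set where
    field
      g     : Fin n → Fin n → Fin N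
      z~g   : ∀ i j → Adj z (g i j)
      g-inj : ∀ {i j k l} → g i j ≡ g k l → i ≡ k × j ≡ l
      onto  : ∀ {v} → Adj z v → ∃[ i ] ∃[ j ] (g i j ≡ v)
      reflect  : ∀ {i j k l} → Adj (g i j) (g k l) → GridAdj i j k l
      preserve : ∀ {i j k l} → GridAdj i j k l → Adj (g i j) (g k l)

    g≢z : ∀ i j → g i j ≢ z
    g≢z i j g≡z = irrefl (subst (Adj z) g≡z (z~g i j))

    -- Coordinates of a neighbour of z; the default point o is returned
    -- for other vertices, which makes row and column total functions.
    coords : Fin n → Fin N → Fin n × Fin n
    coords o v with adj? z v
    ... | yes z~v = let i , j , _ = onto z~v in i , j
    ... | no  _   = o , o

    row col : Fin n → Fin N → Fin n
    row o = proj₁ ∘ coords o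
    col o = proj₂ ∘ coords o

    coords-spec : ∀ o {v} → Adj z v → g (row o v) (col o v) ≡ v
    coords-spec o {v} z~v with adj? z v
    ... | yes z~v′ = proj₂ (proj₂ (onto z~v′))
    ... | no  z≁v  = ⊥-elim (z≁v z~v)

    same-coords⇒≡ : ∀ o {u v} → Adj z u → Adj z v →
      row o u ≡ row o v → col o u ≡ col o v → u ≡ v
    same-coords⇒≡ o z~u z~v r≡ c≡ =
      trans (sym (coords-spec o z~u)) (trans (cong₂ g r≡ c≡) (coords-spec o z~v))

    same-row⇒Adj : ∀ o {u v} → Adj z u → Adj z v → u ≢ v → row o u ≡ row o v → Adj u v
    same-row⇒Adj o {u} {v} z~u z~v u≢v r≡ =
      subst₂ Adj (coords-spec o z~u) (coords-spec o z~v)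
        (preserve (inj₁ (r≡ , λ c≡ → u≢v (same-coords⇒≡ o z~u z~v r≡ c≡))))

    same-col⇒Adj : ∀ o {u v} → Adj z u → Adj z v → u ≢ v → col o u ≡ col o v → Adj u v
    same-col⇒Adj o {u} {v} z~u z~v u≢v c≡ =
      subst₂ Adj (coords-spec o z~u) (coords-spec o z~v)
        (preserve (inj₂ ((λ r≡ → u≢v (same-coords⇒≡ o z~u z~v r≡ c≡)) , c≡)))

  local-chart : LocallyGridAt G n z → Chart z
  local-chart (f , z~f , f-inj , f-onto , f-adj) = record
    { g = f ; z~g = z~f ; g-inj = f-inj _ _ _ _ ; onto = f-onto _
    ; reflect = proj₁ (f-adj _ _ _ _) ; preserve = proj₂ (f-adj _ _ _ _) }

  transpose : Chart z → Chart z
  transpose R = record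
    { g = λ i j → g j i ; z~g = λ i j → z~g j i
    ; g-inj = swap ∘ g-inj
    ; onto = λ z~v → let i , j , g≡v = onto z~v in j , i , g≡v
    ; reflect = GridAdj-transpose ∘ reflect
    ; preserve = preserve ∘ GridAdj-transpose }
    where open Chart R

  -- (B) Two distinct non-adjacent vertices x, y have no three pairwise
  -- adjacent common neighbours p, q, s: in the chart at s, x and y would be
  -- distinct common neighbours of the edge pq, hence adjacent.
  common-neighbours-triangle-free : LocallyGrid G n → x ≢ y → ¬ Adj x y →
    CommonNbr G x y p → CommonNbr G x y q → CommonNbr G x y s →
    Adj p q → Adj s p → Adj s q → ⊥
  common-neighbours-triangle-free {x} {y} {p} {q} {s} Γ-grid x≢y x≁y
    (x~p , y~p) (x~q , y~q) (x~s , y~s) p~q s~p s~q = in-chart (local-chart (Γ-grid s))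
    where
    in-chart : Chart s → ⊥
    in-chart R with Chart.onto R (Adj-sym x~s) | Chart.onto R (Adj-sym y~s)
                  | Chart.onto R s~p | Chart.onto R s~q
    ... | _ , _ , refl | _ , _ , refl | _ , _ , refl | _ , _ , refl =
      x≁y (preserve (edge-common-neighbours-adjacent (reflect p~q)
        (reflect (Adj-sym x~p)) (reflect (Adj-sym x~q))
        (reflect (Adj-sym y~p)) (reflect (Adj-sym y~q))
        λ (≡₁ , ≡₂) → x≢y (cong₂ g ≡₁ ≡₂)))
      where open Chart R

  open GraphFacts G

  module Lines {C : Subset N} (C-max : IsMaximalClique G C) {z : Fin N} (z∈C : z ∈ C) where
    open MaximalClique C-max

    z~ : ∀ {v} → v ∈ C → v ≢ z → Adj z v
    z~ v∈C v≢z = C-clique _ _ z∈C v∈C (v≢z ∘ sym)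

    OnRow : Chart z → Fin n → Set
    OnRow R a = ∀ {v} → v ∈ C → v ≢ z → ∃ λ k → Chart.g R a k ≡ v

    module InChart (R : Chart z) where
      open Chart R

      -- By maximality a row containing C \ {z} lies in C: a row point outside
      -- C would have a non-neighbour in C, yet it is adjacent to z and to
      -- every other point of its row.
      row-saturated : ∀ {a} → OnRow R a → ∀ k → g a k ∈ C
      row-saturated {a} on-row k with g a k ∈? C
      ... | yes ak∈C = ak∈C
      ... | no  ak∉C with non-neighbour ak∉C
      ...   | c , c∈C , c≢ak , c≁ak
        with on-row c∈C (λ c≡z → c≁ak (subst (λ t → Adj t (g a k)) (sym c≡z) (z~g a k)))
      ...     | e , refl = ⊥-elim (c≁ak (preserve (inj₁ (refl , λ e≡k → c≢ak (cong (g a) e≡k)))))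

      -- Two members of C on row a force C \ {z} onto row a: a member off the
      -- row would be adjacent to both, hence share a column with both.
      two-on-row : ∀ {a b k} → b ≢ k → g a b ∈ C → g a k ∈ C → OnRow R a
      two-on-row {a} {b} {k} b≢k ab∈C ak∈C v∈C v≢z with onto (z~ v∈C v≢z)
      ... | c , d , refl with c ≟ᶠ a
      ...   | yes refl = d , refl
      ...   | no  c≢a  = ⊥-elim (b≢k (trans (sym (same-column ab∈C)) (same-column ak∈C)))
        where
        same-column : ∀ {e} → g a e ∈ C → d ≡ e
        same-column ae∈C with reflect (C-clique _ _ v∈C ae∈C (c≢a ∘ proj₁ ∘ g-inj))
        ... | inj₁ (c≡a , _) = ⊥-elim (c≢a c≡a)
        ... | inj₂ (_ , d≡e) = d≡e

      -- A member g a b of C alone on its row and on its column is the only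
      -- member of C \ {z}, as every other member is adjacent to it.
      alone-on-lines : ∀ {a b} → g a b ∈ C →
        (∀ {k} → k ≢ b → g a k ∉ C) → (∀ {k} → k ≢ a → g k b ∉ C) → OnRow R a
      alone-on-lines {a} {b} ab∈C row-empty col-empty v∈C v≢z with onto (z~ v∈C v≢z)
      ... | c , d , refl with g c d ≟ᶠ g a b
      ...   | yes cd≡ab = b , sym cd≡ab
      ...   | no  cd≢ab with reflect (C-clique _ _ v∈C ab∈C cd≢ab)
      ...     | inj₁ (refl , d≢b) = ⊥-elim (row-empty d≢b v∈C)
      ...     | inj₂ (c≢a , refl) = ⊥-elim (col-empty c≢a v∈C)

    record Line : Set where
      field
        chart  : Chart z
        i      : Fin n
        on-row : OnRow chart i

    -- Any member w ≠ z of C determines the line: the row of w if C meets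
    -- it again, the column of w if C meets that, and either one otherwise.
    line-through : Chart z → ∀ {w} → w ∈ C → w ≢ z → Line
    line-through R w∈C w≢z with Chart.onto R (z~ w∈C w≢z)
    ... | a , b , refl = line-from w∈C
      where
      open Chart R
      open InChart
      line-from : g a b ∈ C → Line
      line-from ab∈C with any? (λ k → ¬? (k ≟ᶠ b) ×-dec (g a k ∈? C))
      ... | yes (k , k≢b , ak∈C) = record
        { chart = R ; i = a ; on-row = two-on-row R (k≢b ∘ sym) ab∈C ak∈C }
      ... | no row-empty with any? (λ k → ¬? (k ≟ᶠ a) ×-dec (g k b ∈? C))
      ...   | yes (k , k≢a , kb∈C) = record
        { chart = transpose R ; i = b ; on-row = two-on-row (transpose R) (k≢a ∘ sym) ab∈C kb∈C }
      ...   | no col-empty = record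
        { chart = R ; i = a
        ; on-row = alone-on-lines R ab∈C (λ k≢b ak∈C → row-empty (_ , k≢b , ak∈C))
                                         (λ k≢a kb∈C → col-empty (_ , k≢a , kb∈C)) }

    module LineFacts (L : Line) where
      open Line L public
      open Chart chart public

      on-line : ∀ k → g i k ∈ C
      on-line = InChart.row-saturated chart on-row

      off-line : ∀ {u} → Adj z u → u ∉ C → row i u ≢ i
      off-line {u} z~u u∉C r≡i = u∉C (subst (_∈ C) (coords-spec i z~u)
        (subst (λ t → g t (col i u) ∈ C) (sym r≡i) (on-line (col i u))))

      off-line-adjacent : ∀ {u} → Adj z u → u ∉ C → Adj u (g i (col i u))
      off-line-adjacent {u} z~u u∉C = subst (λ t → Adj t (g i (col i u))) (coords-spec i z~u)
        (preserve (inj₂ (off-line z~u u∉C , refl)))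

      off-line-unique : ∀ {u v} → Adj z u → u ∉ C → v ∈ C → v ≢ z → Adj u v →
        v ≡ g i (col i u)
      off-line-unique {u} z~u u∉C v∈C v≢z u~v with on-row v∈C v≢z
      ... | k , refl with reflect (subst (λ t → Adj t (g i k)) (sym (coords-spec i z~u)) u~v)
      ...   | inj₁ (r≡i , _) = ⊥-elim (off-line z~u u∉C r≡i)
      ...   | inj₂ (_ , c≡k) = cong (g i) (sym c≡k)

module Lemma4-4 (G : Graph) (n : ℕ) (Γ-grid : LocallyGrid G n)
                {x : Fin (Graph.N G)} {C : Subset (Graph.N G)}
                (C-max : IsMaximalClique G C) (x∉C : x ∉ C) where
  open Graph G renaming (sym to Adj-sym)
  open GraphFacts G
  open MaximalClique C-max
  open Charts G n

  x≢ : ∀ {v} → v ∈ C → x ≢ v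
  x≢ v∈C x≡v = x∉C (subst (_∈ C) (sym x≡v) v∈C)

  line-at : ∀ {z u} (z∈C : z ∈ C) → Adj z u → Lines.Line C-max z∈C
  line-at {z} z∈C z~u = let w , w∈C , w≢z = second-member z∈C z~u in
    Lines.line-through C-max z∈C (local-chart (Γ-grid z)) w∈C w≢z

  module Distance1 {z} (z∈C : z ∈ C) (x~z : Adj x z) where
    open Lines.LineFacts C-max z∈C (line-at z∈C (Adj-sym x~z))

    z~x : Adj z x
    z~x = Adj-sym x~z

    b : Fin n
    b = col i x

    x~ib : Adj x (g i b)
    x~ib = off-line-adjacent z~x x∉C

    x-neighbour-in-C : ∀ {v} → v ∈ C → Adj x v → v ≢ z → v ≡ g i b
    x-neighbour-in-C v∈C x~v v≢z = off-line-unique z~x x∉C v∈C v≢z x~v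

    C∩Γ₁ : HasSize (λ v → v ∈ C × Adj x v) 2
    C∩Γ₁ = z ∷ g i b ∷ [] , ((g≢z i b ∘ sym) ∷ []) ∷ [] ∷ []
         , (λ v → listed , complete) , refl
      where
      listed : ∀ {v} → v ∈ₗ z ∷ g i b ∷ [] → v ∈ C × Adj x v
      listed (here refl)         = z∈C , x~z
      listed (there (here refl)) = on-line b , x~ib
      complete : ∀ {v} → v ∈ C × Adj x v → v ∈ₗ z ∷ g i b ∷ []
      complete {v} (v∈C , x~v) with v ≟ᶠ z
      ... | yes refl = here refl
      ... | no  v≢z  = there (here (x-neighbour-in-C v∈C x~v v≢z))

    C∩Γ₂ : HasSize (λ v → v ∈ C × Γ_ G 2 x v) (n ∸ 1)
    C∩Γ₂ with punctured-image b (g i) (proj₂ ∘ g-inj)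
    ... | vs , u-vs , listed , complete , |vs| = vs , u-vs , (λ v → in-Γ₂ ∘ listed , complete′) , |vs|
      where
      in-Γ₂ : ∀ {v} → (∃ λ k → k ≢ b × g i k ≡ v) → v ∈ C × Γ_ G 2 x v
      in-Γ₂ (k , k≢b , refl) = on-line k , Γ₂-intro x~z (z~g i k) (x≢ (on-line k))
        (λ x~ik → k≢b (proj₂ (g-inj (x-neighbour-in-C (on-line k) x~ik (g≢z i k)))))
      complete′ : ∀ {v} → v ∈ C × Γ_ G 2 x v → v ∈ₗ vs
      complete′ (v∈C , x→v) with on-row v∈C (λ v≡z → Γ₂⇒≁ x→v (subst (Adj x) (sym v≡z) x~z))
      ... | k , refl = complete (λ k≡b → Γ₂⇒≁ x→v (subst (λ t → Adj x (g i t)) (sym k≡b) x~ib))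

  module Distance2 (C-far : ∀ {c} → c ∈ C → ¬ Adj x c)
                   {y} (y∈C : y ∈ C) (x→y : Γ_ G 2 x y) where
    open Lines.LineFacts C-max y∈C (line-at y∈C (Adj-sym (proj₂ (proj₂ (Γ₂-middle x→y)))))

    CN : Fin N → Set
    CN = CommonNbr G x y

    CN⇒∉C : ∀ {u} → CN u → u ∉ C
    CN⇒∉C (x~u , _) u∈C = C-far u∈C x~u

    at-most-two : (r : Fin N → Fin n) →
      (∀ {u v} → Adj y u → Adj y v → u ≢ v → r u ≡ r v → Adj u v) →
      ∀ {ys} → (∀ v → v ∈ₗ ys → CN v) → FibreCounting.AtMostTwoPerFibre _≟ᶠ_ r ys
    at-most-two r same⇒adj ys⊆CN {p} {q} {s} p∈ q∈ s∈ p≢q p≢s q≢s rp≡rq rp≡rs =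
      common-neighbours-triangle-free Γ-grid (Γ₂⇒≢ x→y) (Γ₂⇒≁ x→y) cp cq cs
        (same⇒adj (proj₂ cp) (proj₂ cq) p≢q rp≡rq)
        (same⇒adj (proj₂ cs) (proj₂ cp) (p≢s ∘ sym) (sym rp≡rs))
        (same⇒adj (proj₂ cs) (proj₂ cq) (q≢s ∘ sym) (trans (sym rp≡rs) rp≡rq))
      where
      cp : CN p
      cp = ys⊆CN p p∈
      cq : CN q
      cq = ys⊆CN q q∈
      cs : CN s
      cs = ys⊆CN s s∈

    -- Rows of common neighbours avoid the line row i: c₂(x,y) ≤ 2(n - 1).
    c₂-bound : AtMost CN (2 * (n ∸ 1))
    c₂-bound ys u-ys ys⊆CN
      with FibreCounting.half-image _≟ᶠ_ (row i) ys u-ys (at-most-two (row i) (same-row⇒Adj i) ys⊆CN)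
    ... | I , u-I , realised , |ys|≤2|I| =
      ≤-trans |ys|≤2|I| (*-monoʳ-≤ 2 (unique-avoiding⇒length≤n∸1 u-I i∉I))
      where
      i∉I : All (i ≢_) I
      i∉I = All.tabulate λ r∈I i≡r → let u , u∈ys , row≡r = realised r∈I in
        off-line (proj₂ (ys⊆CN _ u∈ys)) (CN⇒∉C (ys⊆CN _ u∈ys)) (trans row≡r (sym i≡r))

    -- c₂(x,y) = 2m gives at least m columns, whose line points lie in Γ₂(x).
    C∩Γ₂-bound : (m : ℕ) → HasSize CN (2 * m) → AtLeast (λ v → v ∈ C × Γ_ G 2 x v) (m + 1)
    C∩Γ₂-bound m (ys , u-ys , ys⇔CN , |ys|≡2m) = from-columns (λ v → proj₁ (ys⇔CN v))
      where
      from-columns : (∀ v → v ∈ₗ ys → CN v) → AtLeast (λ v → v ∈ C × Γ_ G 2 x v) (m + 1)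
      from-columns ys⊆CN
        with FibreCounting.half-image _≟ᶠ_ (col i) ys u-ys (at-most-two (col i) (same-col⇒Adj i) ys⊆CN)
      ... | I , u-I , realised , |ys|≤2|I| =
        y ∷ map (g i) I , y∉ ∷ Unique.map⁺ (proj₂ ∘ g-inj) u-I , listed , length-bound
        where
        y∉ : All (y ≢_) (map (g i) I)
        y∉ = All.tabulate λ v∈ y≡v → let b , _ , v≡ = ∈-map⁻ (g i) v∈ in
          g≢z i b (trans (sym v≡) (sym y≡v))
        -- The line point in the column of a common neighbour u is in Γ₂(x), via u
        listed : ∀ v → v ∈ₗ y ∷ map (g i) I → v ∈ C × Γ_ G 2 x v
        listed _ (here refl) = y∈C , x→y
        listed _ (there v∈) with ∈-map⁻ (g i) v∈
        ... | b , b∈I , refl with realised b∈I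
        ...   | u , u∈ys , refl = on-line (col i u) ,
          Γ₂-intro (proj₁ (ys⊆CN _ u∈ys)) (off-line-adjacent (proj₂ (ys⊆CN _ u∈ys)) (CN⇒∉C (ys⊆CN _ u∈ys)))
                   (x≢ (on-line (col i u))) (C-far (on-line (col i u)))
        m≤|I| : m ≤ length I
        m≤|I| = *-cancelˡ-≤ 2 (subst (_≤ 2 * length I) |ys|≡2m |ys|≤2|I|)
        length-bound : m + 1 ≤ length (y ∷ map (g i) I)
        length-bound = subst₂ _≤_ (+-comm 1 m) (cong suc (sym (length-map (g i) I))) (s≤s m≤|I|)

  part-1 : DistSet G x C 1 →
    HasSize (λ v → v ∈ C × Adj x v) 2 × HasSize (λ v → v ∈ C × Γ_ G 2 x v) (n ∸ 1)
  part-1 ((z , z∈C , x→z) , _) = Distance1.C∩Γ₁ z∈C (walk₁⇒Adj x→z) , Distance1.C∩Γ₂ z∈C (walk₁⇒Adj x→z)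

  part-2 : DistSet G x C 2 → (y : Fin N) → y ∈ C → Γ_ G 2 x y →
      AtMost (CommonNbr G x y) (2 * (n ∸ 1))
    × ((m : ℕ) → HasSize (CommonNbr G x y) (2 * m) → AtLeast (λ v → v ∈ C × Γ_ G 2 x v) (m + 1))
  part-2 d₂ y y∈C x→y = Distance2.c₂-bound C-far y∈C x→y , Distance2.C∩Γ₂-bound C-far y∈C x→y
    where
    C-far : ∀ {c} → c ∈ C → ¬ Adj x c
    C-far = at-distance-two⇒non-adjacent d₂

lemma4p4 : (G : Graph) (n : ℕ) → LocallyGrid G n →
    (x : Vertex G) (C : Subset (Graph.N G)) →
    IsMaximalClique G C → x ∉ C →
    (DistSet G x C 1 →
        HasSize (λ v → v ∈ C × Graph.Adj G x v) 2
      × HasSize (λ v → v ∈ C × Γ_ G 2 x v) (n ∸ 1))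
    × (DistSet G x C 2 →
        (y : Vertex G) → y ∈ C → Γ_ G 2 x y →
          AtMost (CommonNbr G x y) (2 * (n ∸ 1))
        × ((m : ℕ) → HasSize (CommonNbr G x y) (2 * m) →
             AtLeast (λ v → v ∈ C × Γ_ G 2 x v) (m + 1)))
lemma4p4 G n Γ-grid x C C-max x∉C = part-1 , part-2
  where open Lemma4-4 G n Γ-grid C-max x∉C
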